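{- Let $t\ge 2$ and $\lambda\ge 1$ be integers and let $D$ be a $(t,\lambda)$-liking digraph. If $D$ is also a $(t-1,\lambda+1)$-liking digraph, then $D$ is isomorphic to the complete digraph $\overleftrightarrow{K}_{t+\lambda}$ on $t+\lambda$ vertices.
   Context: All digraphs are finite and have no loops and no multiple arcs. For positive integers $s,\mu$, a digraph $D$ is an $(s,\mu)$-liking digraph if every set of $s$ distinct vertices of $D$ has exactly $\mu$ common out-neighbors (the definition presumes $D$ has at least $s$ vertices). $\overleftrightarrow{K}_n$ is the digraph on $n$ vertices with both arcs between every pair of distinct vertices. -}

module Defs where

open import Data.Nat using (ℕ; _≤_; _+_)
open import Data.Bool using (Bool; true; false; T; not; _∨_; T?)
open import Data.Fin using (Fin)
open import Data.Fin.Subset using (Subset; ∣_∣; _∈_)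
open import Data.Fin.Subset.Properties using (_∈?_)
open import Data.Fin.Properties using (all?)
open import Data.Vec using (tabulate)
open import Relation.Nullary using (¬_; does)
open import Relation.Nullary.Decidable using (⌊_⌋)
open import Relation.Binary.PropositionalEquality using (_≡_; _≢_)
open import Function.Bundles using (_⤖_; Bijection)

-- A digraph with vertex set Fin n; the arc relation is a Boolean function.
-- No loops is required; no multiple arcs is automatic.
record Digraph (n : ℕ) : Set where
  field
    arc      : Fin n → Fin n → Bool
    loopless : ∀ v → arc v v ≡ false
open Digraph public

-- w is a common out-neighbour of S  iff  every v ∈ S has an arc v → w
-- (boolean form: for all v, v ∉ S or arc v w).
commonOut : ∀ {n} → Digraph n → Subset n → Subset n
commonOut D S =
  tabulate (λ w → ⌊ all? (λ v → T? (not ⌊ v ∈? S ⌋ ∨ arc D v w)) ⌋)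

Liking : ∀ {n} → ℕ → ℕ → Digraph n → Set
Liking {n} s μ D =
  s ≤ n × (∀ (S : Subset n) → ∣ S ∣ ≡ s → ∣ commonOut D S ∣ ≡ μ)
  where open import Data.Product using (_×_)

complete : (m : ℕ) → Digraph m
complete m = record { arc = λ u v → not (does (u Data.Fin.≟ v)) ; loopless = loopless' }
  where
  open import Data.Fin using (_≟_)
  open import Relation.Nullary.Decidable using (dec-true)
  open import Relation.Binary.PropositionalEquality using (refl; cong)
  loopless' : ∀ v → not (does (v Data.Fin.≟ v)) ≡ false
  loopless' v = cong not (dec-true (v Data.Fin.≟ v) refl)

record _≅_ {n m : ℕ} (D : Digraph n) (E : Digraph m) : Set where
  field
    bij      : Fin n ⤖ Fin m
    preserve : ∀ u v → arc D u v ≡ arc E (Bijection.to bij u) (Bijection.to bij v)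

module Submission where

-- Put a = t − 1, b = λ, and write N⁺ S for the set of common out-neighbours of S. For an a-set
-- S and a vertex w ∉ S, the b members of N⁺ (S ∪ {w}) are the members of N⁺ S that w points
-- to, so w misses exactly one vertex of N⁺ S; for w ∈ N⁺ S that vertex is w itself, hence N⁺ S
-- spans a complete digraph. Swapping s ∈ S for c ∈ N⁺ S keeps N⁺ S − c among the common
-- out-neighbours, and the one remaining common out-neighbour must be s, since any other would
-- point to all of N⁺ S; so S ∪ N⁺ S spans a complete digraph. A vertex outside S ∪ N⁺ S would,
-- after two such swaps, miss two members of one common out-neighbourhood. Hence N⁺ S is the
-- complement of S, D is complete and n = a + (b + 1) = t + λ.

open import Defs
open import Data.Bool using (Bool; T; not; _∨_; T?)
open import Data.Bool.Properties using (T-≡)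
open import Data.Empty using (⊥-elim)
open import Data.Fin using (Fin; zero; suc; _≟_)
open import Data.Fin.Subset
  using (Subset; inside; outside; ⁅_⁆; _∪_; _-_; ∁; ∣_∣; _∈_; _∉_; _⊆_; Nonempty)
  renaming (⊥ to ∅)
open import Data.Fin.Subset.Properties
  using ( _∈?_; drop-there; ∪-identityʳ; p─⊥≡p; ∣⊥∣≡0; ∣p∣≤n; p⊆q⇒∣p∣≤∣q∣; ⊆-refl; ⊆-antisym
        ; x∈p∪q⁺; x∈p∪q⁻; p⊆p∪q; x∈⁅x⁆; x∈⁅y⁆⇒x≡y; x∈p∧x≢y⇒x∈p-y; p─q⊆p
        ; x∉p⇒x∈∁p; x∈∁p⇒x∉p; ∣∁p∣≡n∸∣p∣)
open import Data.Nat using (ℕ; suc; _≤_; _<_; _+_; _∸_; z≤n; s≤s)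
open import Data.Nat.Properties
  using (+-comm; +-suc; <⇒≤; <-irrefl; suc-injective; n<1+n; m+[n∸m]≡n; module ≤-Reasoning)
open import Data.Product using (∃; _×_; _,_; map)
open import Data.Sum using (inj₁; inj₂; [_,_])
open import Data.Unit using (tt)
open import Data.Vec using (_∷_; tabulate; here; there)
open import Data.Vec.Properties using ([]=⇒lookup; lookup⇒[]=; lookup∘tabulate)
open import Function using (_∘_; _⇔_; mk⇔; Equivalence)
open import Function.Construct.Identity using (⤖-id)
open import Relation.Nullary using (¬_; Dec; yes; no; does; contradiction)
open import Relation.Nullary.Decidable using (⌊_⌋; toWitness; fromWitness)
open import Relation.Binary.PropositionalEquality
  using (_≡_; _≢_; refl; sym; trans; cong; cong₂; subst; subst₂; module ≡-Reasoning)

private variable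
  n k : ℕ
  p q : Subset n
  x y : Fin n
  σ τ : Bool

T-not⌊⌋∨⇔ : ∀ {A : Set} (a? : Dec A) {b : Bool} → T (not ⌊ a? ⌋ ∨ b) ⇔ (A → T b)
T-not⌊⌋∨⇔ (yes a) = mk⇔ (λ t _ → t) (λ f → f a)
T-not⌊⌋∨⇔ (no ¬a) = mk⇔ (λ _ a → contradiction a ¬a) (λ _ → tt)

x∈tabulate⇔ : ∀ {f : Fin n → Bool} → x ∈ tabulate f ⇔ T (f x)
x∈tabulate⇔ {x = x} {f} = mk⇔
  (λ x∈ → Equivalence.from T-≡ (trans (sym (lookup∘tabulate f x)) ([]=⇒lookup x∈)))
  (λ fx → lookup⇒[]= x (tabulate f) (trans (lookup∘tabulate f x) (Equivalence.to T-≡ fx)))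

∣p∪⁅x⁆∣≡1+∣p∣ : x ∉ p → ∣ p ∪ ⁅ x ⁆ ∣ ≡ suc ∣ p ∣
∣p∪⁅x⁆∣≡1+∣p∣ {x = zero} {p = inside  ∷ p}  x∉p = contradiction here x∉p
∣p∪⁅x⁆∣≡1+∣p∣ {x = zero} {p = outside ∷ p}  _   = cong (suc ∘ ∣_∣) (∪-identityʳ p)
∣p∪⁅x⁆∣≡1+∣p∣ {x = suc x} {p = inside  ∷ p} x∉p = cong suc (∣p∪⁅x⁆∣≡1+∣p∣ (x∉p ∘ there))
∣p∪⁅x⁆∣≡1+∣p∣ {x = suc x} {p = outside ∷ p} x∉p = ∣p∪⁅x⁆∣≡1+∣p∣ (x∉p ∘ there)

1+∣p-x∣≡∣p∣ : x ∈ p → suc ∣ p - x ∣ ≡ ∣ p ∣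
1+∣p-x∣≡∣p∣ {p = inside  ∷ p} here        = cong (suc ∘ ∣_∣) (p─⊥≡p p)
1+∣p-x∣≡∣p∣ {p = inside  ∷ p} (there x∈p) = cong suc (1+∣p-x∣≡∣p∣ x∈p)
1+∣p-x∣≡∣p∣ {p = outside ∷ p} (there x∈p) = 1+∣p-x∣≡∣p∣ x∈p

∣p-x∪⁅y⁆∣≡∣p∣ : x ∈ p → y ∉ p → ∣ (p - x) ∪ ⁅ y ⁆ ∣ ≡ ∣ p ∣
∣p-x∪⁅y⁆∣≡∣p∣ {x = x} {p = p} x∈p y∉p =
  trans (∣p∪⁅x⁆∣≡1+∣p∣ (y∉p ∘ p─q⊆p p ⁅ x ⁆)) (1+∣p-x∣≡∣p∣ x∈p)

x∈p-y⇒x≢y : x ∈ p - y → x ≢ y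
x∈p-y⇒x≢y {x = suc x} {p = _ ∷ _} {y = suc y} (there x∈p-y) refl = x∈p-y⇒x≢y x∈p-y refl

∃-there : (∃ λ x → x ∈ q × x ∉ p) → ∃ λ x → x ∈ σ ∷ q × x ∉ τ ∷ p
∃-there = map suc (map there (_∘ drop-there))

∣p∣<∣q∣⇒∃x∈q∖p : ∣ p ∣ < ∣ q ∣ → ∃ λ x → x ∈ q × x ∉ p
∣p∣<∣q∣⇒∃x∈q∖p {p = outside ∷ p} {inside  ∷ q} _ = zero , here , λ ()
∣p∣<∣q∣⇒∃x∈q∖p {p = inside  ∷ p} {inside  ∷ q} (s≤s ∣p∣<∣q∣) = ∃-there (∣p∣<∣q∣⇒∃x∈q∖p ∣p∣<∣q∣)
∣p∣<∣q∣⇒∃x∈q∖p {p = outside ∷ p} {outside ∷ q} ∣p∣<∣q∣ = ∃-there (∣p∣<∣q∣⇒∃x∈q∖p ∣p∣<∣q∣)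
∣p∣<∣q∣⇒∃x∈q∖p {p = inside  ∷ p} {outside ∷ q} ∣p∣<∣q∣ = ∃-there (∣p∣<∣q∣⇒∃x∈q∖p (<⇒≤ ∣p∣<∣q∣))

0<∣p∣⇒Nonempty : 0 < ∣ p ∣ → Nonempty p
0<∣p∣⇒Nonempty {n} {p} 0<∣p∣ =
  let x , x∈p , _ = ∣p∣<∣q∣⇒∃x∈q∖p {p = ∅} (subst (_< ∣ p ∣) (sym (∣⊥∣≡0 n)) 0<∣p∣)
  in x , x∈p

subset-of-size : k ≤ n → ∃ λ (p : Subset n) → ∣ p ∣ ≡ k
subset-of-size {n = n} z≤n = ∅ , ∣⊥∣≡0 n
subset-of-size (s≤s k≤n) = let p , ∣p∣≡k = subset-of-size k≤n in inside ∷ p , cong suc ∣p∣≡k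

module DigraphProperties {n} (D : Digraph n) where

  infix 4 _↝_
  _↝_ : Fin n → Fin n → Set
  u ↝ v = T (arc D u v)

  N⁺ : Subset n → Subset n
  N⁺ = commonOut D

  ↝-irrefl : ∀ {v} → ¬ v ↝ v
  ↝-irrefl {v} = subst T (loopless D v)

  ∈commonOut⁺ : ∀ {S w} → (∀ {v} → v ∈ S → v ↝ w) → w ∈ N⁺ S
  ∈commonOut⁺ {S} S↝w =
    Equivalence.from x∈tabulate⇔
      (fromWitness (λ v → Equivalence.from (T-not⌊⌋∨⇔ (v ∈? S)) S↝w))

  ∈commonOut⁻ : ∀ {S v w} → w ∈ N⁺ S → v ∈ S → v ↝ w
  ∈commonOut⁻ {S} {v} w∈N⁺S =
    Equivalence.to (T-not⌊⌋∨⇔ (v ∈? S)) (toWitness (Equivalence.to x∈tabulate⇔ w∈N⁺S) v)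

  commonOut-disjoint : ∀ {S w} → w ∈ N⁺ S → w ∉ S
  commonOut-disjoint w∈N⁺S w∈S = ↝-irrefl (∈commonOut⁻ w∈N⁺S w∈S)

  commonOut-≢-member : ∀ {S v w} → w ∈ N⁺ S → v ∈ S → w ≢ v
  commonOut-≢-member w∈N⁺S v∈S refl = commonOut-disjoint w∈N⁺S v∈S

  commonOut-antitone : ∀ {S S′} → S ⊆ S′ → N⁺ S′ ⊆ N⁺ S
  commonOut-antitone S⊆S′ w∈N⁺S′ = ∈commonOut⁺ (∈commonOut⁻ w∈N⁺S′ ∘ S⊆S′)

  ∈commonOut-∪⁅⁆ : ∀ {S w x} → w ∈ N⁺ S → x ↝ w → w ∈ N⁺ (S ∪ ⁅ x ⁆)
  ∈commonOut-∪⁅⁆ {S} {w} {x} w∈N⁺S x↝w = ∈commonOut⁺ (λ {v} v∈ →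
    [ ∈commonOut⁻ w∈N⁺S , (λ v∈⁅x⁆ → subst (_↝ w) (sym (x∈⁅y⁆⇒x≡y x v∈⁅x⁆)) x↝w) ]
      (x∈p∪q⁻ S ⁅ x ⁆ v∈))

  ≅complete : ∀ {m} → n ≡ m → (∀ {u v} → u ≢ v → u ↝ v) → D ≅ complete m
  ≅complete refl ≢⇒↝ = record { bij = ⤖-id _ ; preserve = arc≡ }
    where
    arc≡ : ∀ u v → arc D u v ≡ not (does (u ≟ v))
    arc≡ u v with u ≟ v
    ... | yes refl = loopless D u
    ... | no u≢v   = Equivalence.to T-≡ (≢⇒↝ u≢v)

module ConsecutiveLiking {n} (D : Digraph n) {a b : ℕ} (0<a : 0 < a) (0<b : 0 < b)
  (∣N⁺S∣≡1+b : ∀ S → ∣ S ∣ ≡ a → ∣ commonOut D S ∣ ≡ suc b)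
  (∣N⁺T∣≡b : ∀ T → ∣ T ∣ ≡ suc a → ∣ commonOut D T ∣ ≡ b)
  where

  open DigraphProperties D

  private variable
    S X : Subset n
    s c c′ u v w : Fin n

  ∣S∪⁅w⁆∣≡1+a : ∣ S ∣ ≡ a → w ∉ S → ∣ S ∪ ⁅ w ⁆ ∣ ≡ suc a
  ∣S∪⁅w⁆∣≡1+a ∣S∣≡a w∉S = trans (∣p∪⁅x⁆∣≡1+∣p∣ w∉S) (cong suc ∣S∣≡a)

  ∣S-s∪⁅c⁆∣≡a : ∣ S ∣ ≡ a → s ∈ S → c ∈ N⁺ S → ∣ (S - s) ∪ ⁅ c ⁆ ∣ ≡ a
  ∣S-s∪⁅c⁆∣≡a ∣S∣≡a s∈S c∈N⁺S = trans (∣p-x∪⁅y⁆∣≡∣p∣ s∈S (commonOut-disjoint c∈N⁺S)) ∣S∣≡a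

  ∣N⁺S-c∣≡b : ∣ S ∣ ≡ a → c ∈ N⁺ S → ∣ N⁺ S - c ∣ ≡ b
  ∣N⁺S-c∣≡b {S} ∣S∣≡a c∈N⁺S = suc-injective (trans (1+∣p-x∣≡∣p∣ c∈N⁺S) (∣N⁺S∣≡1+b S ∣S∣≡a))

  N⁺S-c-nonempty : ∣ S ∣ ≡ a → c ∈ N⁺ S → Nonempty (N⁺ S - c)
  N⁺S-c-nonempty ∣S∣≡a c∈N⁺S = 0<∣p∣⇒Nonempty (subst (0 <_) (sym (∣N⁺S-c∣≡b ∣S∣≡a c∈N⁺S)) 0<b)

  misses-at-most-one : ∀ {x y} → ∣ S ∣ ≡ a → w ∉ S → x ∈ N⁺ S → y ∈ N⁺ S → x ≢ y →
                       ¬ w ↝ x → w ↝ y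
  misses-at-most-one {S} {w} {x} {y} ∣S∣≡a w∉S x∈N⁺S y∈N⁺S x≢y w↛x with T? (arc D w y)
  ... | yes w↝y = w↝y
  ... | no w↛y  = contradiction size-bound (<-irrefl refl)
    where
    N⁺S+w⊆N⁺S-x-y : N⁺ (S ∪ ⁅ w ⁆) ⊆ N⁺ S - x - y
    N⁺S+w⊆N⁺S-x-y {z} z∈ =
      x∈p∧x≢y⇒x∈p-y (x∈p∧x≢y⇒x∈p-y (commonOut-antitone (p⊆p∪q ⁅ w ⁆) z∈) λ { refl → w↛x w↝z })
                     λ { refl → w↛y w↝z }
      where w↝z = ∈commonOut⁻ z∈ (x∈p∪q⁺ (inj₂ (x∈⁅x⁆ w)))
    open ≤-Reasoning
    size-bound : suc (suc b) ≤ suc b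
    size-bound = begin
      suc (suc b)                   ≡⟨ cong (2 +_) (∣N⁺T∣≡b _ (∣S∪⁅w⁆∣≡1+a ∣S∣≡a w∉S)) ⟨
      suc (suc ∣ N⁺ (S ∪ ⁅ w ⁆) ∣) ≤⟨ s≤s (s≤s (p⊆q⇒∣p∣≤∣q∣ N⁺S+w⊆N⁺S-x-y)) ⟩
      suc (suc ∣ N⁺ S - x - y ∣)    ≡⟨ cong suc (1+∣p-x∣≡∣p∣ (x∈p∧x≢y⇒x∈p-y y∈N⁺S (x≢y ∘ sym))) ⟩
      suc ∣ N⁺ S - x ∣              ≡⟨ 1+∣p-x∣≡∣p∣ x∈N⁺S ⟩
      ∣ N⁺ S ∣                      ≡⟨ ∣N⁺S∣≡1+b S ∣S∣≡a ⟩
      suc b                         ∎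

  commonOut-complete : ∣ S ∣ ≡ a → u ∈ N⁺ S → v ∈ N⁺ S → u ≢ v → u ↝ v
  commonOut-complete ∣S∣≡a u∈N⁺S v∈N⁺S u≢v =
    misses-at-most-one ∣S∣≡a (commonOut-disjoint u∈N⁺S) u∈N⁺S v∈N⁺S u≢v ↝-irrefl

  misses-some : ∣ S ∣ ≡ a → w ∉ S → X ⊆ N⁺ S → ∣ X ∣ ≡ suc b → ∃ λ x → x ∈ X × ¬ w ↝ x
  misses-some {S} {w} {X} ∣S∣≡a w∉S X⊆N⁺S ∣X∣≡1+b =
    let x , x∈X , x∉N⁺S+w = ∣p∣<∣q∣⇒∃x∈q∖p ∣N⁺S+w∣<∣X∣
    in x , x∈X , x∉N⁺S+w ∘ ∈commonOut-∪⁅⁆ (X⊆N⁺S x∈X)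
    where
    ∣N⁺S+w∣<∣X∣ : ∣ N⁺ (S ∪ ⁅ w ⁆) ∣ < ∣ X ∣
    ∣N⁺S+w∣<∣X∣ = subst₂ _<_ (sym (∣N⁺T∣≡b _ (∣S∪⁅w⁆∣≡1+a ∣S∣≡a w∉S))) (sym ∣X∣≡1+b) (n<1+n b)

  commonOut-swap⊇ : ∣ S ∣ ≡ a → c ∈ N⁺ S → N⁺ S - c ⊆ N⁺ ((S - s) ∪ ⁅ c ⁆)
  commonOut-swap⊇ {S} {c} {s} ∣S∣≡a c∈N⁺S x∈N⁺S-c =
    ∈commonOut-∪⁅⁆ (commonOut-antitone (p─q⊆p S ⁅ s ⁆) x∈N⁺S)
                   (commonOut-complete ∣S∣≡a c∈N⁺S x∈N⁺S (x∈p-y⇒x≢y x∈N⁺S-c ∘ sym))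
    where x∈N⁺S = p─q⊆p _ _ x∈N⁺S-c

  ∉swap : w ∉ S → w ∉ N⁺ S → c ∈ N⁺ S → w ∉ (S - s) ∪ ⁅ c ⁆
  ∉swap {S = S} {c = c} {s = s} w∉S w∉N⁺S c∈N⁺S =
    [ w∉S ∘ p─q⊆p S ⁅ s ⁆ , (λ w∈⁅c⁆ → w∉N⁺S (subst (_∈ N⁺ S) (sym (x∈⁅y⁆⇒x≡y c w∈⁅c⁆)) c∈N⁺S)) ]
      ∘ x∈p∪q⁻ (S - s) ⁅ c ⁆

  swap-commonOut↝swapped-in : ∀ {y} → ∣ S ∣ ≡ a → s ∈ S → c ∈ N⁺ S → c′ ∈ N⁺ S - c →
                              y ∈ N⁺ ((S - s) ∪ ⁅ c ⁆) → y ≢ c′ → y ↝ c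
  swap-commonOut↝swapped-in {S} {s} {c} {c′} {y} ∣S∣≡a s∈S c∈N⁺S c′∈N⁺S-c y∈N⁺S′ y≢c′ =
    commonOut-complete (∣S-s∪⁅c⁆∣≡a ∣S∣≡a s∈S c′∈N⁺S) y∈N⁺S″ c∈N⁺S″ y≢c
    where
    c′∈N⁺S : c′ ∈ N⁺ S
    c′∈N⁺S = p─q⊆p _ _ c′∈N⁺S-c
    c′↝y : c′ ↝ y
    c′↝y = commonOut-complete (∣S-s∪⁅c⁆∣≡a ∣S∣≡a s∈S c∈N⁺S)
             (commonOut-swap⊇ ∣S∣≡a c∈N⁺S c′∈N⁺S-c) y∈N⁺S′ (y≢c′ ∘ sym)
    y∈N⁺S″ : y ∈ N⁺ ((S - s) ∪ ⁅ c′ ⁆)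
    y∈N⁺S″ = ∈commonOut-∪⁅⁆ (commonOut-antitone (p⊆p∪q ⁅ c ⁆) y∈N⁺S′) c′↝y
    c∈N⁺S″ : c ∈ N⁺ ((S - s) ∪ ⁅ c′ ⁆)
    c∈N⁺S″ = commonOut-swap⊇ ∣S∣≡a c′∈N⁺S (x∈p∧x≢y⇒x∈p-y c∈N⁺S (x∈p-y⇒x≢y c′∈N⁺S-c ∘ sym))
    y≢c : y ≢ c
    y≢c = commonOut-≢-member y∈N⁺S′ (x∈p∪q⁺ (inj₂ (x∈⁅x⁆ c)))

  swap-newcomer↝commonOut : ∀ {x y} → ∣ S ∣ ≡ a → s ∈ S → c ∈ N⁺ S →
                            y ∈ N⁺ ((S - s) ∪ ⁅ c ⁆) → y ∉ N⁺ S - c → x ∈ N⁺ S → y ↝ x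
  swap-newcomer↝commonOut {c = c} {x = x} ∣S∣≡a s∈S c∈N⁺S y∈N⁺S′ y∉N⁺S-c x∈N⁺S with x ≟ c
  ... | yes refl =
    let c′ , c′∈N⁺S-c = N⁺S-c-nonempty ∣S∣≡a c∈N⁺S
    in swap-commonOut↝swapped-in ∣S∣≡a s∈S c∈N⁺S c′∈N⁺S-c y∈N⁺S′ λ { refl → y∉N⁺S-c c′∈N⁺S-c }
  ... | no x≢c =
    commonOut-complete (∣S-s∪⁅c⁆∣≡a ∣S∣≡a s∈S c∈N⁺S) y∈N⁺S′ (commonOut-swap⊇ ∣S∣≡a c∈N⁺S x∈N⁺S-c)
                       λ { refl → y∉N⁺S-c x∈N⁺S-c }
    where x∈N⁺S-c = x∈p∧x≢y⇒x∈p-y x∈N⁺S x≢c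

  swapped-out∈commonOut : ∣ S ∣ ≡ a → s ∈ S → c ∈ N⁺ S → s ∈ N⁺ ((S - s) ∪ ⁅ c ⁆)
  swapped-out∈commonOut {S} {s} {c} ∣S∣≡a s∈S c∈N⁺S with ∣p∣<∣q∣⇒∃x∈q∖p ∣N⁺S-c∣<∣N⁺S′∣
    where
    ∣N⁺S-c∣<∣N⁺S′∣ : ∣ N⁺ S - c ∣ < ∣ N⁺ ((S - s) ∪ ⁅ c ⁆) ∣
    ∣N⁺S-c∣<∣N⁺S′∣ = subst₂ _<_ (sym (∣N⁺S-c∣≡b ∣S∣≡a c∈N⁺S))
                       (sym (∣N⁺S∣≡1+b _ (∣S-s∪⁅c⁆∣≡a ∣S∣≡a s∈S c∈N⁺S))) (n<1+n b)
  ... | y , y∈N⁺S′ , y∉N⁺S-c with y ≟ s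
  ...   | yes refl = y∈N⁺S′
  ...   | no y≢s   =
    let x , x∈N⁺S , y↛x = misses-some ∣S∣≡a y∉S ⊆-refl (∣N⁺S∣≡1+b S ∣S∣≡a)
    in contradiction (swap-newcomer↝commonOut ∣S∣≡a s∈S c∈N⁺S y∈N⁺S′ y∉N⁺S-c x∈N⁺S) y↛x
    where
    y∉S : y ∉ S
    y∉S y∈S = commonOut-disjoint y∈N⁺S′ (x∈p∪q⁺ (inj₁ (x∈p∧x≢y⇒x∈p-y y∈S y≢s)))

  outsider-misses-member : ∣ S ∣ ≡ a → w ∉ S → w ∉ N⁺ S → c ∈ N⁺ S → ¬ w ↝ c → s ∈ S → ¬ w ↝ s
  outsider-misses-member {S} {w} {c} {s} ∣S∣≡a w∉S w∉N⁺S c∈N⁺S w↛c s∈S w↝s =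
    let x , x∈Y , w↛x = misses-some (∣S-s∪⁅c⁆∣≡a ∣S∣≡a s∈S c∈N⁺S) (∉swap w∉S w∉N⁺S c∈N⁺S) Y⊆ ∣Y∣≡1+b
    in w↛x (w↝Y x∈Y)
    where
    Y : Subset n
    Y = (N⁺ S - c) ∪ ⁅ s ⁆
    s∉N⁺S-c : s ∉ N⁺ S - c
    s∉N⁺S-c s∈N⁺S-c = commonOut-disjoint (p─q⊆p (N⁺ S) ⁅ c ⁆ s∈N⁺S-c) s∈S
    Y⊆ : Y ⊆ N⁺ ((S - s) ∪ ⁅ c ⁆)
    Y⊆ = [ commonOut-swap⊇ ∣S∣≡a c∈N⁺S
         , (λ x∈⁅s⁆ → subst (_∈ _) (sym (x∈⁅y⁆⇒x≡y s x∈⁅s⁆))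
                              (swapped-out∈commonOut ∣S∣≡a s∈S c∈N⁺S)) ]
         ∘ x∈p∪q⁻ (N⁺ S - c) ⁅ s ⁆
    ∣Y∣≡1+b : ∣ Y ∣ ≡ suc b
    ∣Y∣≡1+b = trans (∣p∪⁅x⁆∣≡1+∣p∣ s∉N⁺S-c) (cong suc (∣N⁺S-c∣≡b ∣S∣≡a c∈N⁺S))
    w↝Y : ∀ {x} → x ∈ Y → w ↝ x
    w↝Y = [ (λ x∈N⁺S-c → misses-at-most-one ∣S∣≡a w∉S c∈N⁺S (p─q⊆p _ _ x∈N⁺S-c)
                            (x∈p-y⇒x≢y x∈N⁺S-c ∘ sym) w↛c)
          , (λ x∈⁅s⁆ → subst (w ↝_) (sym (x∈⁅y⁆⇒x≡y s x∈⁅s⁆)) w↝s) ]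
          ∘ x∈p∪q⁻ (N⁺ S - c) ⁅ s ⁆

  commonOut-covers : ∣ S ∣ ≡ a → w ∉ S → w ∈ N⁺ S
  commonOut-covers {S} {w} ∣S∣≡a w∉S with w ∈? N⁺ S
  ... | yes w∈N⁺S = w∈N⁺S
  ... | no  w∉N⁺S =
    let c , c∈N⁺S , w↛c = misses-some ∣S∣≡a w∉S ⊆-refl (∣N⁺S∣≡1+b S ∣S∣≡a)
        s , s∈S = 0<∣p∣⇒Nonempty (subst (0 <_) (sym ∣S∣≡a) 0<a)
        c′ , c′∈N⁺S-c = N⁺S-c-nonempty ∣S∣≡a c∈N⁺S
        c′∈N⁺S = p─q⊆p (N⁺ S) ⁅ c ⁆ c′∈N⁺S-c
    -- c and s are both common out-neighbours of (S - s) ∪ ⁅ c′ ⁆, and w misses both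
    in ⊥-elim (outsider-misses-member ∣S∣≡a w∉S w∉N⁺S c∈N⁺S w↛c s∈S
         (misses-at-most-one (∣S-s∪⁅c⁆∣≡a ∣S∣≡a s∈S c′∈N⁺S) (∉swap w∉S w∉N⁺S c′∈N⁺S)
            (commonOut-swap⊇ ∣S∣≡a c′∈N⁺S (x∈p∧x≢y⇒x∈p-y c∈N⁺S (x∈p-y⇒x≢y c′∈N⁺S-c ∘ sym)))
            (swapped-out∈commonOut ∣S∣≡a s∈S c′∈N⁺S)
            (commonOut-≢-member c∈N⁺S s∈S) w↛c))

  commonOut≡∁ : ∣ S ∣ ≡ a → N⁺ S ≡ ∁ S
  commonOut≡∁ ∣S∣≡a =
    ⊆-antisym (x∉p⇒x∈∁p ∘ commonOut-disjoint) (commonOut-covers ∣S∣≡a ∘ x∈∁p⇒x∉p)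

  n≡a+1+b : ∀ S → ∣ S ∣ ≡ a → n ≡ a + suc b
  n≡a+1+b S ∣S∣≡a = begin
    n                   ≡⟨ m+[n∸m]≡n (∣p∣≤n S) ⟨
    ∣ S ∣ + (n ∸ ∣ S ∣) ≡⟨ cong (∣ S ∣ +_) (∣∁p∣≡n∸∣p∣ S) ⟨
    ∣ S ∣ + ∣ ∁ S ∣     ≡⟨ cong (∣ S ∣ +_) (cong ∣_∣ (commonOut≡∁ ∣S∣≡a)) ⟨
    ∣ S ∣ + ∣ N⁺ S ∣    ≡⟨ cong₂ _+_ ∣S∣≡a (∣N⁺S∣≡1+b S ∣S∣≡a) ⟩
    a + suc b           ∎
    where open ≡-Reasoning

  ≢⇒↝ : ∀ S → ∣ S ∣ ≡ a → u ≢ v → u ↝ v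
  ≢⇒↝ {u} {v} S ∣S∣≡a u≢v with u ∈? S | v ∈? S
  ... | yes u∈S | yes v∈S =
    let c , c∈N⁺S = 0<∣p∣⇒Nonempty (subst (0 <_) (sym (∣N⁺S∣≡1+b S ∣S∣≡a)) (s≤s z≤n))
    in ∈commonOut⁻ (swapped-out∈commonOut ∣S∣≡a v∈S c∈N⁺S)
                   (x∈p∪q⁺ (inj₁ (x∈p∧x≢y⇒x∈p-y u∈S u≢v)))
  ... | yes u∈S | no v∉S = ∈commonOut⁻ (commonOut-covers ∣S∣≡a v∉S) u∈S
  ... | no u∉S  | yes v∈S =
    ∈commonOut⁻ (swapped-out∈commonOut ∣S∣≡a v∈S (commonOut-covers ∣S∣≡a u∉S))
                (x∈p∪q⁺ (inj₂ (x∈⁅x⁆ u)))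
  ... | no u∉S  | no v∉S =
    commonOut-complete ∣S∣≡a (commonOut-covers ∣S∣≡a u∉S) (commonOut-covers ∣S∣≡a v∉S) u≢v

lemma3p4 : ∀ {n : ℕ} (t λ' : ℕ) → 2 ≤ t → 1 ≤ λ' → (D : Digraph n) →
    Liking t λ' D → Liking (t ∸ 1) (λ' + 1) D → D ≅ complete (t + λ')
lemma3p4 (suc a) b (s≤s 0<a) 0<b D (1+a≤n , ∣N⁺T∣≡b) (_ , ∣N⁺S∣≡b+1)
  with subset-of-size (<⇒≤ 1+a≤n)
... | S , ∣S∣≡a = ≅complete (trans (n≡a+1+b S ∣S∣≡a) (+-suc a b)) (≢⇒↝ S ∣S∣≡a)
  where
  open DigraphProperties D
  open ConsecutiveLiking D 0<a 0<b (λ S ∣S∣≡a → trans (∣N⁺S∣≡b+1 S ∣S∣≡a) (+-comm b 1)) ∣N⁺T∣≡b
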